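{- Let $\mathrm{CA}$ be the characteristic sequence of the Cantor integers, i.e. $\mathrm{CA}(n)=1$ if the base-$3$ representation of $n$ uses only the digits $0$ and $2$, and $\mathrm{CA}(n)=0$ otherwise. Then the running sum $\mathrm{sum}_{\mathrm{CA}}(n)=\sum_{i=0}^{n}\mathrm{CA}(i)$ is $(3,2)$-synchronised.
   Context: A function $f:\mathbb{N}\to\mathbb{N}$ is $(3,2)$-synchronised if there is a finite automaton which, reading in parallel the base-$3$ representation of $n$ and the base-$2$ representation of $m$ (most significant digit first, the shorter padded with leading zeros), accepts exactly the pairs $(n,m)$ with $m=f(n)$. -}

module Defs where

open import Data.Nat using (ℕ; zero; suc; _+_; _*_; _^_; _<_; _<ᵇ_; NonZero)
open import Data.Nat.DivMod using (_/_; _%_; m%n<n)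
open import Data.Bool using (Bool; true; false; _∧_; if_then_else_)
open import Data.Fin using (Fin; fromℕ<)
open import Data.Product using (_×_; _,_; Σ; ∃)
open import Data.List using (List; []; _∷_; foldl; map; upTo)
open import Data.Nat.ListAction using (sum)
open import Relation.Binary.PropositionalEquality using (_≡_)

digitAt : (b : ℕ) → .{{NonZero b}} → ℕ → ℕ → Fin b
digitAt b n zero    = fromℕ< (m%n<n n b)
digitAt b n (suc i) = digitAt b (n / b) i

padded : (b : ℕ) → .{{NonZero b}} → (L n : ℕ) → List (Fin b)
padded b zero    n = []
padded b (suc L) n = digitAt b n L ∷ padded b L n

-- least L ≥ start (searching with the given fuel) such that n < 3^L and m < 2^L
-- (i.e. the common length of the base-3 rep. of n and base-2 rep. of m,
-- where 0 has the empty representation)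
searchLen : ℕ → ℕ → ℕ → ℕ → ℕ
searchLen zero       start n m = start
searchLen (suc fuel) start n m =
  if (n <ᵇ 3 ^ start) ∧ (m <ᵇ 2 ^ start) then start
  else searchLen fuel (suc start) n m

-- n + m + 1 is enough fuel since n < 3^n and m < 2^m
commonLen : ℕ → ℕ → ℕ
commonLen n m = searchLen (suc (n + m)) 0 n m

zipL : {A B : Set} → List A → List B → List (A × B)
zipL (a ∷ as) (b ∷ bs) = (a , b) ∷ zipL as bs
zipL _ _ = []

-- the input word read by the automaton for the pair (n , m):
-- base-3 digits of n in parallel with base-2 digits of m, msd first,
-- shorter one padded with leading zeros
pairWord : ℕ → ℕ → List (Fin 3 × Fin 2)
pairWord n m = zipL (padded 3 L n) (padded 2 L m)
  where L = commonLen n m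

record DFA (Σ : Set) : Set₁ where
  field
    size   : ℕ
    start  : Fin size
    step   : Fin size → Σ → Fin size
    accept : Fin size → Bool

  run : List Σ → Fin size
  run w = foldl step start w

  Accepts : List Σ → Set
  Accepts w = accept (run w) ≡ true

Synchronised32 : (ℕ → ℕ) → Set₁
Synchronised32 f = Σ (DFA (Fin 3 × Fin 2)) λ A →
  ∀ n m → (DFA.Accepts A (pairWord n m) → m ≡ f n)
        × (m ≡ f n → DFA.Accepts A (pairWord n m))

noDigit1 : ℕ → ℕ → Bool
noDigit1 zero    n = true
noDigit1 (suc k) n with n % 3
... | 1 = false
... | _ = noDigit1 k (n / 3)

-- characteristic sequence CA (fuel n suffices: n has at most n base-3 digits)
CA : ℕ → ℕ
CA n = if noDigit1 n n then 1 else 0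

sumCA : ℕ → ℕ
sumCA n = sum (map CA (upTo (suc n)))

{-# OPTIONS --safe #-}
-- Write n = 3q + r. The Cantor integers up to n are the 3j and 3j + 2 with j ≤ q Cantor,
-- except that 3q + 2 is missing when r ≠ 2; hence  sumCA (3q + r) + c = 2 · sumCA q,
-- where c = 1 iff q is Cantor and r ≠ 2. Reading n in base 3 and m in base 2 in
-- parallel, most significant digit first, the difference δ = sumCA n − m of the prefixes
-- read so far therefore evolves as δ ↦ 2δ − c − e, e the new binary digit. Once δ leaves
-- {0, 1} it never comes back, so an automaton remembering whether the prefix of n is
-- Cantor and the value of δ when it lies in {0, 1} decides m = sumCA n at the end.
module Submission where

open import Defs
open import Data.Nat using (ℕ; zero; suc; _+_; _*_; _^_; _≤_; _<_; _<ᵇ_; z≤n; s≤s; NonZero)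
open import Data.Nat.Properties
open import Data.Nat.DivMod
open import Data.Nat.Tactic.RingSolver using (solve-∀)
open import Data.Bool using (Bool; true; false; _∧_; if_then_else_; T)
open import Data.Bool.Properties using (T-∧)
open import Data.Fin using (Fin; toℕ)
open import Data.Fin.Patterns
open import Data.Fin.Properties using (toℕ-fromℕ<; toℕ<n; toℕ-injective)
open import Data.Maybe using (Maybe; just; nothing; _>>=_)
open import Data.Product using (_×_; _,_; ∃-syntax; proj₁; proj₂)
open import Data.List using (List; []; _∷_; foldl; map; upTo; length; _∷ʳ_; [_])
open import Data.List.Properties using (foldl-∷ʳ; upTo-∷ʳ; map-++)
open import Data.Nat.ListAction using (sum)
open import Data.Nat.ListAction.Properties using (sum-++)
open import Data.Unit using (tt)
open import Function using (_∘_)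
open import Function.Bundles using (Equivalence)
open import Relation.Nullary using (contradiction)
open import Relation.Binary.PropositionalEquality using (_≡_; _≢_; refl; sym; trans; cong; cong₂; subst; subst₂; module ≡-Reasoning)

module _ (b : ℕ) .{{_ : NonZero b}} where

  digitAt-decomposition : ∀ n → toℕ (digitAt b n 0) + (n / b) * b ≡ n
  digitAt-decomposition n =
    trans (cong (_+ (n / b) * b) (toℕ-fromℕ< (m%n<n n b))) (sym (m≡m%n+[m/n]*n n b))

  [r+q*b]%b≡r : ∀ {r} q → r < b → (r + q * b) % b ≡ r
  [r+q*b]%b≡r {r} q r<b = trans ([m+kn]%n≡m%n r q b) (m<n⇒m%n≡m r<b)

  [r+q*b]/b≡q : ∀ {r} q → r < b → (r + q * b) / b ≡ q
  [r+q*b]/b≡q {r} q r<b = begin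
    (r + q * b) / b        ≡⟨ +-distrib-/ r (q * b) remainders<b ⟩
    r / b + q * b / b      ≡⟨ cong₂ _+_ (m<n⇒m/n≡0 r<b) (m*n/n≡m q b) ⟩
    q                      ∎
    where
    open ≡-Reasoning
    remainders<b : r % b + (q * b) % b < b
    remainders<b = subst₂ (λ x y → x + y < b) (sym (m<n⇒m%n≡m r<b)) (sym (m*n%n≡0 q b))
                          (subst (_< b) (sym (+-identityʳ r)) r<b)

  /-<-^ : ∀ {n} L → n < b ^ suc L → n / b < b ^ L
  /-<-^ {n} L n<b^1+L = m<n*o⇒m/o<n (subst (n <_) (*-comm b (b ^ L)) n<b^1+L)

  length-padded : ∀ L n → length (padded b L n) ≡ L
  length-padded zero    n = refl
  length-padded (suc L) n = cong suc (length-padded L n)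

  padded-suc : ∀ L n → padded b (suc L) n ≡ padded b L (n / b) ∷ʳ digitAt b n 0
  padded-suc zero    n = refl
  padded-suc (suc L) n = cong (digitAt b (n / b) L ∷_) (padded-suc L n)

zipL-∷ʳ : ∀ {A B : Set} (xs : List A) (ys : List B) x y → length xs ≡ length ys →
          zipL (xs ∷ʳ x) (ys ∷ʳ y) ≡ zipL xs ys ∷ʳ (x , y)
zipL-∷ʳ []       []       x y _  = refl
zipL-∷ʳ (a ∷ xs) (b ∷ ys) x y eq = cong ((a , b) ∷_) (zipL-∷ʳ xs ys x y (suc-injective eq))

module _ {b c : ℕ} .{{_ : NonZero b}} .{{_ : NonZero c}} {S : Set}
         (step : S → Fin b × Fin c → S) where

  paddedPair : ℕ → ℕ → ℕ → List (Fin b × Fin c)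
  paddedPair L n m = zipL (padded b L n) (padded c L m)

  foldl-paddedPair-suc : ∀ s L n m →
    foldl step s (paddedPair (suc L) n m) ≡
    step (foldl step s (paddedPair L (n / b) (m / c))) (digitAt b n 0 , digitAt c m 0)
  foldl-paddedPair-suc s L n m = begin
    foldl step s (zipL (padded b (suc L) n) (padded c (suc L) m))
      ≡⟨ cong (foldl step s) (cong₂ zipL (padded-suc b L n) (padded-suc c L m)) ⟩
    foldl step s (zipL (padded b L (n / b) ∷ʳ dn) (padded c L (m / c) ∷ʳ dm))
      ≡⟨ cong (foldl step s) (zipL-∷ʳ (padded b L (n / b)) (padded c L (m / c)) dn dm equalLengths) ⟩
    foldl step s (paddedPair L (n / b) (m / c) ∷ʳ (dn , dm))
      ≡⟨ foldl-∷ʳ step s (dn , dm) (paddedPair L (n / b) (m / c)) ⟩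
    step (foldl step s (paddedPair L (n / b) (m / c))) (dn , dm) ∎
    where
    open ≡-Reasoning
    dn = digitAt b n 0
    dm = digitAt c m 0
    equalLengths : length (padded b L (n / b)) ≡ length (padded c L (m / c))
    equalLengths = trans (length-padded b L (n / b)) (sym (length-padded c L (m / c)))

  module _ (Inv : S → ℕ → ℕ → Set)
           (step-Inv : ∀ {s q m} r e → Inv s q m →
                       Inv (step s (r , e)) (toℕ r + q * b) (toℕ e + m * c)) where

    foldl-paddedPair-Inv : ∀ {s} L {n m} → Inv s 0 0 → n < b ^ L → m < c ^ L →
                           Inv (foldl step s (paddedPair L n m)) n m
    foldl-paddedPair-Inv zero {zero}  {zero}  inv₀ _         _         = inv₀
    foldl-paddedPair-Inv zero {suc _}         _    (s≤s ())  _
    foldl-paddedPair-Inv zero {zero}  {suc _} _    _         (s≤s ())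
    foldl-paddedPair-Inv {s} (suc L) {n} {m} inv₀ n<b^1+L m<c^1+L =
      subst (λ s' → Inv s' n m) (sym (foldl-paddedPair-suc s L n m))
        (subst₂ (Inv _) (digitAt-decomposition b n) (digitAt-decomposition c m)
          (step-Inv (digitAt b n 0) (digitAt c m 0)
            (foldl-paddedPair-Inv L inv₀ (/-<-^ b L n<b^1+L) (/-<-^ c L m<c^1+L))))

n<2^n : ∀ n → n < 2 ^ n
n<2^n zero    = s≤s z≤n
n<2^n (suc n) = +-mono-≤ (m^n>0 2 n) (subst (suc n ≤_) (sym (+-identityʳ (2 ^ n))) (n<2^n n))

n<b^k : ∀ b {n k} → 2 ≤ b → n ≤ k → n < b ^ k
n<b^k b {n} {k} 2≤b n≤k = <-≤-trans (n<2^n n)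
  (≤-trans (^-monoʳ-≤ 2 n≤k) (^-monoˡ-≤ k 2≤b))

Fits : ℕ → ℕ → ℕ → Set
Fits n m L = n < 3 ^ L × m < 2 ^ L

searchLen-Fits : ∀ fuel start {n m} → Fits n m (fuel + start) → Fits n m (searchLen fuel start n m)
searchLen-Fits zero       start           fits = fits
searchLen-Fits (suc fuel) start {n} {m} fits
  with (n <ᵇ 3 ^ start) ∧ (m <ᵇ 2 ^ start) in test
... | true  = let (n<ᵇ , m<ᵇ) = Equivalence.to T-∧ (subst T (sym test) tt)
              in <ᵇ⇒< n (3 ^ start) n<ᵇ , <ᵇ⇒< m (2 ^ start) m<ᵇ
... | false = searchLen-Fits fuel (suc start) (subst (Fits n m) (sym (+-suc fuel start)) fits)

commonLen-Fits : ∀ n m → Fits n m (commonLen n m)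
commonLen-Fits n m =
  searchLen-Fits (suc (n + m)) 0 (n<b^k 3 (s≤s (s≤s z≤n)) n≤fuel , n<b^k 2 ≤-refl m≤fuel)
  where
  n≤fuel : n ≤ suc (n + m) + 0
  n≤fuel = ≤-trans (m≤m+n n m) (≤-trans (n≤1+n _) (m≤m+n _ 0))
  m≤fuel : m ≤ suc (n + m) + 0
  m≤fuel = ≤-trans (m≤n+m m n) (≤-trans (n≤1+n _) (m≤m+n _ 0))

record FiniteAutomaton (A : Set) : Set₁ where
  field
    State         : Set
    size          : ℕ
    encode        : State → Fin size
    decode        : Fin size → State
    decode-encode : ∀ s → decode (encode s) ≡ s
    start         : State
    step          : State → A → State
    accept        : State → Bool

  run : List A → State
  run = foldl step start

  dfa : DFA A
  dfa = record
    { size   = size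
    ; start  = encode start
    ; step   = λ i a → encode (step (decode i) a)
    ; accept = accept ∘ decode
    }

  foldl-encode : ∀ s w → foldl (DFA.step dfa) (encode s) w ≡ encode (foldl step s w)
  foldl-encode s []      = refl
  foldl-encode s (a ∷ w) rewrite decode-encode s = foldl-encode (step s a) w

  accept-dfa-run : ∀ w → DFA.accept dfa (DFA.run dfa w) ≡ accept (run w)
  accept-dfa-run w =
    trans (cong (accept ∘ decode) (foldl-encode start w)) (cong accept (decode-encode (run w)))

module _ (M : FiniteAutomaton (Fin 3 × Fin 2)) (f : ℕ → ℕ) where
  open FiniteAutomaton M

  synchronised-by-invariant :
    (Inv : State → ℕ → ℕ → Set) → Inv start 0 0 →
    (∀ {s q m} r e → Inv s q m → Inv (step s (r , e)) (toℕ r + q * 3) (toℕ e + m * 2)) →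
    (∀ {s n m} → Inv s n m → accept s ≡ true → m ≡ f n) →
    (∀ {s n m} → Inv s n m → m ≡ f n → accept s ≡ true) →
    Synchronised32 f
  synchronised-by-invariant Inv start-Inv step-Inv sound complete = dfa , λ n m →
    let fits = commonLen-Fits n m
        inv  = foldl-paddedPair-Inv step Inv step-Inv (commonLen n m) start-Inv (proj₁ fits) (proj₂ fits)
    in (λ accepted → sound inv (trans (sym (accept-dfa-run (pairWord n m))) accepted))
     , (λ m≡fn → trans (accept-dfa-run (pairWord n m)) (complete inv m≡fn))

isCantor : ℕ → Bool
isCantor n = noDigit1 n n

cantorStep : Bool → ℕ → Bool
cantorStep b zero          = b
cantorStep b (suc zero)    = false
cantorStep b (suc (suc _)) = b

noDigit1-suc : ∀ k n → noDigit1 (suc k) n ≡ cantorStep (noDigit1 k (n / 3)) (n % 3)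
noDigit1-suc k n with n % 3
... | zero          = refl
... | suc zero      = refl
... | suc (suc _)   = refl

noDigit1-zero : ∀ k → noDigit1 k 0 ≡ true
noDigit1-zero zero    = refl
noDigit1-zero (suc k) = noDigit1-zero k

n≤1+k⇒n/3≤k : ∀ {n k} → n ≤ suc k → n / 3 ≤ k
n≤1+k⇒n/3≤k {zero}  _   = z≤n
n≤1+k⇒n/3≤k {suc n} n≤1+k = ≤-pred (≤-trans (m/n<m (suc n) 3 (s≤s (s≤s z≤n))) n≤1+k)

noDigit1-fuel : ∀ {k k' n} → n ≤ k → n ≤ k' → noDigit1 k n ≡ noDigit1 k' n
noDigit1-fuel {zero}  {k'}            z≤n _    = sym (noDigit1-zero k')
noDigit1-fuel {suc k} {zero}          _   z≤n  = noDigit1-zero (suc k)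
noDigit1-fuel {suc k} {suc k'} {n} n≤k n≤k' = begin
  noDigit1 (suc k) n                          ≡⟨ noDigit1-suc k n ⟩
  cantorStep (noDigit1 k (n / 3)) (n % 3)
    ≡⟨ cong (λ b → cantorStep b (n % 3)) (noDigit1-fuel (n≤1+k⇒n/3≤k n≤k) (n≤1+k⇒n/3≤k n≤k')) ⟩
  cantorStep (noDigit1 k' (n / 3)) (n % 3)    ≡⟨ sym (noDigit1-suc k' n) ⟩
  noDigit1 (suc k') n                         ∎
  where open ≡-Reasoning

isCantor-unfold : ∀ n → isCantor n ≡ cantorStep (isCantor (n / 3)) (n % 3)
isCantor-unfold zero    = refl
isCantor-unfold (suc k) = trans (noDigit1-suc k (suc k))
  (cong (λ b → cantorStep b (suc k % 3)) (noDigit1-fuel {k} {suc k / 3} (n≤1+k⇒n/3≤k ≤-refl) ≤-refl))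

isCantor-digit : ∀ q (r : Fin 3) → isCantor (toℕ r + q * 3) ≡ cantorStep (isCantor q) (toℕ r)
isCantor-digit q r = trans (isCantor-unfold (toℕ r + q * 3))
  (cong₂ cantorStep (cong isCantor ([r+q*b]/b≡q 3 q (toℕ<n r))) ([r+q*b]%b≡r 3 q (toℕ<n r)))

CA-digit : ∀ q (r : Fin 3) → CA (toℕ r + q * 3) ≡ (if cantorStep (isCantor q) (toℕ r) then 1 else 0)
CA-digit q r = cong (λ b → if b then 1 else 0) (isCantor-digit q r)

sumCA-suc : ∀ n → sumCA (suc n) ≡ sumCA n + CA (suc n)
sumCA-suc n = begin
  sum (map CA (upTo (suc (suc n))))             ≡⟨ cong (sum ∘ map CA) (sym (upTo-∷ʳ (suc n))) ⟩
  sum (map CA (upTo (suc n) ∷ʳ suc n))          ≡⟨ cong sum (map-++ CA (upTo (suc n)) [ suc n ]) ⟩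
  sum (map CA (upTo (suc n)) ∷ʳ CA (suc n))     ≡⟨ sum-++ (map CA (upTo (suc n))) [ CA (suc n) ] ⟩
  sumCA n + (CA (suc n) + 0)                    ≡⟨ cong (sumCA n +_) (+-identityʳ _) ⟩
  sumCA n + CA (suc n)                          ∎
  where open ≡-Reasoning

sumCA-3q+2 : ∀ q → sumCA (2 + q * 3) ≡ sumCA q * 2
sumCA-3q+2 zero    = refl
sumCA-3q+2 (suc q) = begin
  sumCA (5 + q * 3)
    ≡⟨ sumCA-suc (4 + q * 3) ⟩
  sumCA (4 + q * 3) + CA (5 + q * 3)
    ≡⟨ cong (_+ CA (5 + q * 3)) (sumCA-suc (3 + q * 3)) ⟩
  sumCA (3 + q * 3) + CA (4 + q * 3) + CA (5 + q * 3)
    ≡⟨ cong (λ x → x + CA (4 + q * 3) + CA (5 + q * 3)) (sumCA-suc (2 + q * 3)) ⟩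
  sumCA (2 + q * 3) + CA (3 + q * 3) + CA (4 + q * 3) + CA (5 + q * 3)
    ≡⟨ cong₂ (λ x y → x + CA (3 + q * 3) + y + CA (5 + q * 3)) (sumCA-3q+2 q) (CA-digit (suc q) 1F) ⟩
  sumCA q * 2 + CA (3 + q * 3) + 0 + CA (5 + q * 3)
    ≡⟨ cong₂ (λ x y → sumCA q * 2 + x + 0 + y) (CA-digit (suc q) 0F) (CA-digit (suc q) 2F) ⟩
  sumCA q * 2 + CA (suc q) + 0 + CA (suc q)
    ≡⟨ regroup (sumCA q) (CA (suc q)) ⟩
  (sumCA q + CA (suc q)) * 2
    ≡⟨ cong (_* 2) (sym (sumCA-suc q)) ⟩
  sumCA (suc q) * 2 ∎
  where
  open ≡-Reasoning
  regroup : ∀ s c → s * 2 + c + 0 + c ≡ (s + c) * 2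
  regroup = solve-∀

indicator : Bool → Fin 2
indicator true  = 1F
indicator false = 0F

if-indicator : ∀ b → (if b then 1 else 0) ≡ toℕ (indicator b)
if-indicator true  = refl
if-indicator false = refl

deficit : Bool → Fin 3 → Fin 2
deficit b 0F = indicator b
deficit b 1F = indicator b
deficit b 2F = 0F

sumCA-3q+1≡sumCA-3q : ∀ q → sumCA (1 + q * 3) ≡ sumCA (q * 3)
sumCA-3q+1≡sumCA-3q q =
  trans (sumCA-suc (q * 3)) (trans (cong (sumCA (q * 3) +_) (CA-digit q 1F)) (+-identityʳ _))

sumCA-digit : ∀ q (r : Fin 3) → sumCA (toℕ r + q * 3) + toℕ (deficit (isCantor q) r) ≡ sumCA q * 2
sumCA-digit q 0F = trans (cong (_+ toℕ (deficit (isCantor q) 0F)) (sym (sumCA-3q+1≡sumCA-3q q)))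
                         (sumCA-digit q 1F)
sumCA-digit q 1F = begin
  sumCA (1 + q * 3) + toℕ (deficit (isCantor q) 1F)
    ≡⟨ cong (sumCA (1 + q * 3) +_) (sym (trans (CA-digit q 2F) (if-indicator (isCantor q)))) ⟩
  sumCA (1 + q * 3) + CA (2 + q * 3)
    ≡⟨ sym (sumCA-suc (1 + q * 3)) ⟩
  sumCA (2 + q * 3)
    ≡⟨ sumCA-3q+2 q ⟩
  sumCA q * 2 ∎
  where open ≡-Reasoning
sumCA-digit q 2F = trans (+-identityʳ _) (sumCA-3q+2 q)

Gap : Maybe (Fin 2) → ℕ → ℕ → Set
Gap (just g) m s = m + toℕ g ≡ s
Gap nothing  m s = ∀ (g : Fin 2) → m + toℕ g ≢ s

Gap-unique : ∀ {m s} {g g' : Fin 2} → m + toℕ g ≡ s → m + toℕ g' ≡ s → g ≡ g'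
Gap-unique {m} p q = toℕ-injective (+-cancelˡ-≡ m _ _ (trans p (sym q)))

nextGap : (e c g : Fin 2) → Maybe (Fin 2)
nextGap 0F 0F 0F = just 0F
nextGap 0F 0F 1F = nothing
nextGap 0F 1F 0F = nothing
nextGap 0F 1F 1F = just 1F
nextGap 1F 0F 0F = nothing
nextGap 1F 0F 1F = just 1F
nextGap 1F 1F 0F = nothing
nextGap 1F 1F 1F = just 0F

nextGap-sound : ∀ e c g {g'} → nextGap e c g ≡ just g' → toℕ e + toℕ c + toℕ g' ≡ toℕ g * 2
nextGap-sound 0F 0F 0F refl = refl
nextGap-sound 0F 0F 1F ()
nextGap-sound 0F 1F 0F ()
nextGap-sound 0F 1F 1F refl = refl
nextGap-sound 1F 0F 0F ()
nextGap-sound 1F 0F 1F refl = refl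
nextGap-sound 1F 1F 0F ()
nextGap-sound 1F 1F 1F refl = refl

odd≢even : ∀ m s → suc (m * 2) ≢ s * 2
odd≢even m s eq = even≢odd s m (trans (*-comm 2 s) (trans (sym eq) (cong suc (*-comm m 2))))

nextGap-complete : ∀ e c g' {m s} → toℕ e + toℕ c + toℕ g' + m * 2 ≡ s * 2 →
                   ∃[ g ] m + toℕ g ≡ s × nextGap e c g ≡ just g'
nextGap-complete 0F 0F 0F {m} {s} eq = 0F , trans (+-identityʳ m) (*-cancelʳ-≡ m s 2 eq) , refl
nextGap-complete 0F 0F 1F {m} {s} eq = contradiction eq (odd≢even m s)
nextGap-complete 0F 1F 0F {m} {s} eq = contradiction eq (odd≢even m s)
nextGap-complete 0F 1F 1F {m} {s} eq = 1F , trans (+-comm m 1) (*-cancelʳ-≡ (suc m) s 2 eq) , refl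
nextGap-complete 1F 0F 0F {m} {s} eq = contradiction eq (odd≢even m s)
nextGap-complete 1F 0F 1F {m} {s} eq = 1F , trans (+-comm m 1) (*-cancelʳ-≡ (suc m) s 2 eq) , refl
nextGap-complete 1F 1F 0F {m} {s} eq = 1F , trans (+-comm m 1) (*-cancelʳ-≡ (suc m) s 2 eq) , refl
nextGap-complete 1F 1F 1F {m} {s} eq = contradiction eq (odd≢even (suc m) s)

module _ {m s s' : ℕ} (e c : Fin 2) (s'+c≡2s : s' + toℕ c ≡ s * 2) where
  private
    E = toℕ e
    C = toℕ c

  doubled-gap : ∀ {g g' : Fin 2} → m + toℕ g ≡ s → E + C + toℕ g' ≡ toℕ g * 2 →
                E + m * 2 + toℕ g' ≡ s'
  doubled-gap {g} {g'} m+g≡s e+c+g'≡2g = +-cancelʳ-≡ C _ _ (begin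
    E + m * 2 + toℕ g' + C     ≡⟨ regroup E C (toℕ g') (m * 2) ⟩
    E + C + toℕ g' + m * 2     ≡⟨ cong (_+ m * 2) e+c+g'≡2g ⟩
    toℕ g * 2 + m * 2          ≡⟨ sym (*-distribʳ-+ 2 (toℕ g) m) ⟩
    (toℕ g + m) * 2            ≡⟨ cong (_* 2) (trans (+-comm (toℕ g) m) m+g≡s) ⟩
    s * 2                      ≡⟨ sym s'+c≡2s ⟩
    s' + C                     ∎)
    where
    open ≡-Reasoning
    regroup : ∀ x y z w → x + w + z + y ≡ x + y + z + w
    regroup = solve-∀

  halved-gap : ∀ {g' : Fin 2} → E + m * 2 + toℕ g' ≡ s' → E + C + toℕ g' + m * 2 ≡ s * 2
  halved-gap {g'} gap' = begin
    E + C + toℕ g' + m * 2     ≡⟨ regroup E C (toℕ g') (m * 2) ⟩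
    E + m * 2 + toℕ g' + C     ≡⟨ cong (_+ C) gap' ⟩
    s' + C                     ≡⟨ s'+c≡2s ⟩
    s * 2                      ∎
    where
    open ≡-Reasoning
    regroup : ∀ x y z w → x + y + z + w ≡ x + w + z + y
    regroup = solve-∀

  Gap-double : ∀ γ → Gap γ m s → Gap (γ >>= nextGap e c) (E + m * 2) s'
  Gap-double (just g) m+g≡s with nextGap e c g in next
  ... | just g' = doubled-gap m+g≡s (nextGap-sound e c g next)
  ... | nothing = λ g' gap' →
    let (g₀ , m+g₀≡s , next₀) = nextGap-complete e c g' (halved-gap gap')
        next-g₀ = subst (λ h → nextGap e c h ≡ nothing) (Gap-unique m+g≡s m+g₀≡s) next
    in contradiction (trans (sym next₀) next-g₀) λ ()
  Gap-double nothing no-gap g' gap' =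
    let (g₀ , m+g₀≡s , _) = nextGap-complete e c g' (halved-gap gap')
    in no-gap g₀ m+g₀≡s

CantorState : Set
CantorState = Bool × Maybe (Fin 2)

encodeCantorState : CantorState → Fin 6
encodeCantorState (false , nothing) = 0F
encodeCantorState (false , just 0F) = 1F
encodeCantorState (false , just 1F) = 2F
encodeCantorState (true  , nothing) = 3F
encodeCantorState (true  , just 0F) = 4F
encodeCantorState (true  , just 1F) = 5F

decodeCantorState : Fin 6 → CantorState
decodeCantorState 0F = false , nothing
decodeCantorState 1F = false , just 0F
decodeCantorState 2F = false , just 1F
decodeCantorState 3F = true  , nothing
decodeCantorState 4F = true  , just 0F
decodeCantorState 5F = true  , just 1F

decode-encodeCantorState : ∀ s → decodeCantorState (encodeCantorState s) ≡ s
decode-encodeCantorState (false , nothing) = refl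
decode-encodeCantorState (false , just 0F) = refl
decode-encodeCantorState (false , just 1F) = refl
decode-encodeCantorState (true  , nothing) = refl
decode-encodeCantorState (true  , just 0F) = refl
decode-encodeCantorState (true  , just 1F) = refl

acceptsZeroGap : CantorState → Bool
acceptsZeroGap (_ , just 0F) = true
acceptsZeroGap (_ , just 1F) = false
acceptsZeroGap (_ , nothing) = false

sumCAAutomaton : FiniteAutomaton (Fin 3 × Fin 2)
sumCAAutomaton = record
  { State         = CantorState
  ; size          = 6
  ; encode        = encodeCantorState
  ; decode        = decodeCantorState
  ; decode-encode = decode-encodeCantorState
  ; start         = true , just 1F   -- sumCA 0 = 1, as 0 is a Cantor integer
  ; step          = λ { (b , γ) (r , e) → cantorStep b (toℕ r) , (γ >>= nextGap e (deficit b r)) }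
  ; accept        = acceptsZeroGap
  }

-- A record rather than a function by cases on s, so that Tracks s n m determines s, n and m.
record Tracks (s : CantorState) (n m : ℕ) : Set where
  constructor tracking
  field
    cantor : isCantor n ≡ proj₁ s
    gap    : Gap (proj₂ s) m (sumCA n)

Tracks-step : ∀ {s q m} r e → Tracks s q m →
              Tracks (FiniteAutomaton.step sumCAAutomaton s (r , e)) (toℕ r + q * 3) (toℕ e + m * 2)
Tracks-step {_ , γ} {q} r e (tracking refl gap) =
  tracking (isCantor-digit q r) (Gap-double e (deficit (isCantor q) r) (sumCA-digit q r) γ gap)

Tracks-sound : ∀ {s n m} → Tracks s n m → acceptsZeroGap s ≡ true → m ≡ sumCA n
Tracks-sound {_ , just 0F} {_} {m} (tracking _ m+0≡s) _ = trans (sym (+-identityʳ m)) m+0≡s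
Tracks-sound {_ , just 1F} _ ()
Tracks-sound {_ , nothing} _ ()

Tracks-complete : ∀ {s n m} → Tracks s n m → m ≡ sumCA n → acceptsZeroGap s ≡ true
Tracks-complete {_ , just 0F}         _                    _   = refl
Tracks-complete {_ , just 1F} {_} {m} (tracking _ m+1≡s)   m≡s =
  contradiction (trans (+-comm 1 m) (trans m+1≡s (sym m≡s))) 1+n≢n
Tracks-complete {_ , nothing} {_} {m} (tracking _ no-gap)  m≡s =
  contradiction (trans (+-identityʳ m) m≡s) (no-gap 0F)

mainTheorem10 : Synchronised32 sumCA
mainTheorem10 = synchronised-by-invariant sumCAAutomaton sumCA
  Tracks (tracking refl refl) Tracks-step Tracks-sound Tracks-complete
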